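{- Let $G'$ be a $(K_8, K_{2,2,2,2,2}, 5)$-cockade, and let $G$ be the graph obtained from $G'$ by adding a new vertex adjacent to at least six vertices of $G'$. Then $G$ has a $K_9^=$ minor.
   Context: All graphs are finite and simple. $K_9^=$ denotes $K_9$ with two edges removed; "has a $K_9^=$ minor" means contains as a minor at least one of the two nonisomorphic graphs obtained from $K_9$ by deleting two edges. An $(H_1,H_2,k)$-cockade is defined recursively: every graph isomorphic to $H_1$ or $H_2$ is one, and the graph obtained from two $(H_1,H_2,k)$-cockades by identifying a $k$-clique of one with a $k$-clique of the other is one; every cockade arises this way. $K_{2,2,2,2,2}$ is the complete 5-partite graph with all parts of size 2. -}

module Defs where

open import Data.Nat using (ℕ; zero; suc; _≤_; _/_)
open import Data.Fin using (Fin; zero; suc; toℕ)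
open import Data.Fin.Subset using (Subset; _∈_; ∣_∣)
open import Data.Maybe using (Maybe; just)
open import Data.Product using (Σ; ∃; _×_; _,_)
open import Data.Sum using (_⊎_; inj₁; inj₂)
open import Data.Empty using (⊥)
open import Relation.Nullary using (¬_)
open import Relation.Binary.PropositionalEquality using (_≡_; _≢_; refl; sym)
open import Function.Bundles using (_↔_; Inverse)

record Graph : Set₁ where
  field
    n      : ℕ
    Adj    : Fin n → Fin n → Set
    adjSym : ∀ {u v} → Adj u v → Adj v u
    irrefl : ∀ {u} → ¬ Adj u u
open Graph public

record _≅_ (G H : Graph) : Set where
  field
    bij  : Fin (n G) ↔ Fin (n H)
    pres : ∀ u v → Adj G u v → Adj H (Inverse.to bij u) (Inverse.to bij v)
    refl' : ∀ u v → Adj H (Inverse.to bij u) (Inverse.to bij v) → Adj G u v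

K : ℕ → Graph
K m = record { n = m ; Adj = λ u v → u ≢ v ; adjSym = λ p q → p (sym q) ; irrefl = λ p → p refl }

part : Fin 10 → ℕ
part v = toℕ v / 2

K22222 : Graph
K22222 = record { n = 10 ; Adj = λ u v → part u ≢ part v
                ; adjSym = λ p q → p (sym q) ; irrefl = λ p → p refl }

SameEdge : ∀ {m} → Fin m → Fin m → Fin m → Fin m → Set
SameEdge x y a b = (x ≡ a × y ≡ b) ⊎ (x ≡ b × y ≡ a)

sameEdge-sym : ∀ {m} {x y a b : Fin m} → SameEdge x y a b → SameEdge y x a b
sameEdge-sym (inj₁ (p , q)) = inj₂ (q , p)
sameEdge-sym (inj₂ (p , q)) = inj₁ (q , p)

K9minus : (a b c d : Fin 9) → Graph
K9minus a b c d = record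
  { n = 9
  ; Adj = λ x y → x ≢ y × ¬ SameEdge x y a b × ¬ SameEdge x y c d
  ; adjSym = λ { (p , q , r) → (λ e → p (sym e)) , (λ e → q (sameEdge-sym e)) , (λ e → r (sameEdge-sym e)) }
  ; irrefl = λ { (p , _) → p refl } }

data WalkIn (G : Graph) (P : Fin (n G) → Set) : Fin (n G) → Fin (n G) → Set where
  here : ∀ {u} → P u → WalkIn G P u u
  step : ∀ {u w v} → P u → Adj G u w → WalkIn G P w v → WalkIn G P u v

-- H is a minor of G: there is a model assigning to each vertex of G at most one
-- vertex of H (branch sets β⁻¹(h) are pairwise disjoint), with each branch set
-- nonempty and connected, and an edge of G between the branch sets of any two
-- adjacent vertices of H.
record MinorModel (H G : Graph) : Set where
  field
    β         : Fin (n G) → Maybe (Fin (n H))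
    nonempty  : ∀ h → ∃ λ v → β v ≡ just h
    connected : ∀ h u v → β u ≡ just h → β v ≡ just h → WalkIn G (λ w → β w ≡ just h) u v
    edges     : ∀ h h' → Adj H h h' →
                ∃ λ u → ∃ λ v → β u ≡ just h × β v ≡ just h' × Adj G u v

_IsMinorOf_ : Graph → Graph → Set
H IsMinorOf G = MinorModel H G

HasK9== : Graph → Set
HasK9== G = Σ (Fin 9) λ a → Σ (Fin 9) λ b → Σ (Fin 9) λ c → Σ (Fin 9) λ d →
  a ≢ b × c ≢ d × ¬ SameEdge a b c d × (K9minus a b c d IsMinorOf G)

record Clique (G : Graph) (k : ℕ) : Set where
  field
    vtx  : Fin k → Fin (n G)
    inj  : ∀ i j → vtx i ≡ vtx j → i ≡ j
    adj  : ∀ i j → i ≢ j → Adj G (vtx i) (vtx j)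

-- G is (up to isomorphism) obtained from G₁ and G₂ by identifying the clique
-- C₁ of G₁ with the clique C₂ of G₂ (vertex vtx C₁ i identified with vtx C₂ i):
-- injective embeddings φ₁, φ₂ covering V(G), overlapping exactly on the
-- identified clique vertices, and E(G) = φ₁(E(G₁)) ∪ φ₂(E(G₂)).
record IsGluing (k : ℕ) (G₁ G₂ : Graph) (C₁ : Clique G₁ k) (C₂ : Clique G₂ k) (G : Graph) : Set where
  field
    φ₁     : Fin (n G₁) → Fin (n G)
    φ₂     : Fin (n G₂) → Fin (n G)
    inj₁'  : ∀ u v → φ₁ u ≡ φ₁ v → u ≡ v
    inj₂'  : ∀ u v → φ₂ u ≡ φ₂ v → u ≡ v
    cover  : ∀ x → (∃ λ u → φ₁ u ≡ x) ⊎ (∃ λ v → φ₂ v ≡ x)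
    glue   : ∀ i → φ₁ (Clique.vtx C₁ i) ≡ φ₂ (Clique.vtx C₂ i)
    onlyGlue : ∀ u v → φ₁ u ≡ φ₂ v →
               ∃ λ i → u ≡ Clique.vtx C₁ i × v ≡ Clique.vtx C₂ i
    adjFrom : ∀ x y → Adj G x y →
              (∃ λ u → ∃ λ u' → φ₁ u ≡ x × φ₁ u' ≡ y × Adj G₁ u u')
              ⊎ (∃ λ v → ∃ λ v' → φ₂ v ≡ x × φ₂ v' ≡ y × Adj G₂ v v')
    adjTo₁ : ∀ u u' → Adj G₁ u u' → Adj G (φ₁ u) (φ₁ u')
    adjTo₂ : ∀ v v' → Adj G₂ v v' → Adj G (φ₂ v) (φ₂ v')

data IsCockade (H₁ H₂ : Graph) (k : ℕ) : Graph → Set₁ where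
  base₁ : ∀ {G} → G ≅ H₁ → IsCockade H₁ H₂ k G
  base₂ : ∀ {G} → G ≅ H₂ → IsCockade H₁ H₂ k G
  glue  : ∀ {G₁ G₂ G} → IsCockade H₁ H₂ k G₁ → IsCockade H₁ H₂ k G₂ →
          (C₁ : Clique G₁ k) (C₂ : Clique G₂ k) →
          IsGluing k G₁ G₂ C₁ C₂ G → IsCockade H₁ H₂ k G

AdjAdd : (G : Graph) → Subset (n G) → Fin (suc (n G)) → Fin (suc (n G)) → Set
AdjAdd G S zero zero = ⊥
AdjAdd G S zero (suc v) = v ∈ S
AdjAdd G S (suc u) zero = u ∈ S
AdjAdd G S (suc u) (suc v) = Adj G u v

addVertex : (G : Graph) → Subset (n G) → Graph
addVertex G S = record { n = suc (n G) ; Adj = AdjAdd G S ; adjSym = λ {u} {v} → s {u} {v} ; irrefl = λ {u} → ir {u} }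
  where
  s : ∀ {u v} → AdjAdd G S u v → AdjAdd G S v u
  s {zero} {zero} ()
  s {zero} {suc v} p = p
  s {suc u} {zero} p = p
  s {suc u} {suc v} p = adjSym G p
  ir : ∀ {u} → ¬ AdjAdd G S u u
  ir {zero} ()
  ir {suc u} p = irrefl G p

-- Two properties are proved together by induction over the cockade: (A) whenever the new vertex
-- has six distinct neighbours in G′, the graph has a K₉= minor; (B) for every 5-clique C and
-- vertex x ∉ C there is a connected set containing x, disjoint from C and adjacent to every
-- vertex of C.  Both are direct for K₈; in K₂,₂,₂,₂,₂ two of the six neighbours fill a part,
-- and K₂,₂,₂,₂,₂ plus a vertex joined to one part contracts to K₉=.  At a clique sum, if the
-- six neighbours lie on one side, (A) for that side applies.  Otherwise some neighbour y lies
-- only on the second side; contracting the set given by (B) for y and the glued clique into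
-- the new vertex leaves the first side with an apex adjacent to the whole clique and to a
-- further neighbour, so (A) for the first side applies.  Property (B) passes to clique sums
-- because every clique lies on one side.
module Submission where

open import Defs
open import Data.Bool using (true; false)
open import Data.Empty using (⊥-elim)
open import Data.Fin using (Fin; zero; suc; toℕ; #_; quotient; combine; punchIn)
open import Data.Fin.Properties
  using (any?; all?; pigeonhole; <⇒≢; ¬∀⟶∃¬; <⇒notInjective; suc-injective; toℕ-injective; punchInᵢ≢i)
  renaming (_≟_ to _≟ᶠ_)
open import Data.Fin.Subset using (Subset; _∈_; _∉_; _⊆_; _∪_; ⁅_⁆; ⊤; ∣_∣)
open import Data.Fin.Subset.Properties using (_∈?_; ∈⊤; x∈⁅x⁆; x∈⁅y⁆⇒x≡y; x∈p∪q⁺; x∈p∪q⁻; p⊆p∪q; q⊆p∪q)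
open import Data.Maybe using (Maybe; just; nothing; _>>=_)
open import Data.Maybe.Properties using (≡-dec)
open import Data.Nat using (ℕ; zero; suc; _≤_; _<_; s≤s) renaming (_≟_ to _≟ℕ_)
open import Data.Nat.Properties using (n<1+n; m<n⇒m<1+n)
open import Data.Product using (Σ; ∃; _×_; _,_; proj₁; proj₂)
open import Data.Sum using (_⊎_; inj₁; inj₂; [_,_]′)
import Data.Sum as Sum
open import Data.Vec using (Vec; []; _∷_; here; there; tabulate; lookup)
open import Data.Vec.Properties using (lookup∘tabulate; lookup⇒[]=; []=⇒lookup)
import Data.Vec.Functional as V
open import Function using (_∘_; id)
open import Level using (0ℓ)
open import Function.Bundles using (Inverse)
open import Function.Definitions using (Injective)
open import Relation.Binary.Core using (_Preserves_⟶_)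
open import Relation.Binary.PropositionalEquality
open import Relation.Nullary using (Dec; yes; no; does; ¬_; ¬?)
open import Relation.Nullary.Decidable using (True; dec-true; toWitness; _×-dec_; _⊎-dec_; _→-dec_)
open import Relation.Unary using (Pred; Decidable)

cons-injective : ∀ {m k} {a : Fin k} {f : Fin m → Fin k} →
                 Injective _≡_ _≡_ f → (∀ i → f i ≢ a) → Injective _≡_ _≡_ (a V.∷ f)
cons-injective f-inj a∉f {zero}  {zero}  _  = refl
cons-injective f-inj a∉f {zero}  {suc j} eq = ⊥-elim (a∉f j (sym eq))
cons-injective f-inj a∉f {suc i} {zero}  eq = ⊥-elim (a∉f i eq)
cons-injective f-inj a∉f {suc i} {suc j} eq = cong suc (f-inj eq)

section-injective : ∀ {A : Set} {m} {f : Fin m → A} (onto : ∀ a → ∃ λ i → f i ≡ a) →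
                    Injective _≡_ _≡_ (proj₁ ∘ onto)
section-injective {f = f} onto {a} {b} eq =
  trans (sym (proj₂ (onto a))) (trans (cong f eq) (proj₂ (onto b)))

extendInjection : ∀ {m k} {f : Fin m → Fin k} → Injective _≡_ _≡_ f → m < k →
                  ∃ λ a → Injective _≡_ _≡_ (a V.∷ f)
extendInjection {m} {k} {f} f-inj m<k with all? (λ a → any? (λ i → f i ≟ᶠ a))
... | yes onto = ⊥-elim (<⇒notInjective m<k (section-injective onto))
... | no ¬onto with ¬∀⟶∃¬ k _ (λ a → any? (λ i → f i ≟ᶠ a)) ¬onto
...   | a , a∉f = a , cons-injective f-inj (λ i fi≡a → a∉f (i , fi≡a))

injective-⊆⇒⊇ : ∀ {k N} {f g : Fin k → Fin N} → Injective _≡_ _≡_ f →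
                (∀ i → ∃ λ j → g j ≡ f i) → ∀ j → ∃ λ i → f i ≡ g j
injective-⊆⇒⊇ {k} {f = f} {g} f-inj f⊆g j with any? (λ i → f i ≟ᶠ g j)
... | yes hit = hit
... | no miss = ⊥-elim (<⇒notInjective (n<1+n k) (cons-injective index-injective j∉index))
  where
  index : Fin k → Fin k
  index = proj₁ ∘ f⊆g
  index-injective : Injective _≡_ _≡_ index
  index-injective {a} {b} eq = f-inj (trans (sym (proj₂ (f⊆g a))) (trans (cong g eq) (proj₂ (f⊆g b))))
  j∉index : ∀ i → index i ≢ j
  j∉index i eq = miss (i , trans (sym (proj₂ (f⊆g i))) (cong g eq))

≤∣∣⇒injection : ∀ {n} (S : Subset n) k → k ≤ ∣ S ∣ →
                Σ (Fin k → Fin n) λ e → Injective _≡_ _≡_ e × (∀ i → e i ∈ S)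
≤∣∣⇒injection [] zero _ = (λ ()) , (λ {}) , (λ ())
≤∣∣⇒injection (false ∷ S) k k≤∣S∣ with ≤∣∣⇒injection S k k≤∣S∣
... | e , e-inj , e∈S = suc ∘ e , e-inj ∘ suc-injective , there ∘ e∈S
≤∣∣⇒injection (true ∷ S) zero _ = (λ ()) , (λ {}) , (λ ())
≤∣∣⇒injection (true ∷ S) (suc k) (s≤s k≤∣S∣) with ≤∣∣⇒injection S k k≤∣S∣
... | e , e-inj , e∈S = zero V.∷ (suc ∘ e) , cons-injective (e-inj ∘ suc-injective) (λ _ ())
                      , λ { zero → here ; (suc i) → there (e∈S i) }

subset : ∀ {n p} {P : Pred (Fin n) p} → Decidable P → Subset n
subset P? = tabulate (does ∘ P?)

∈-subset⁺ : ∀ {n p} {P : Pred (Fin n) p} (P? : Decidable P) {x} → P x → x ∈ subset P?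
∈-subset⁺ P? {x} px = lookup⇒[]= x _ (trans (lookup∘tabulate (does ∘ P?) x) (dec-true (P? x) px))

∈-subset⁻ : ∀ {n p} {P : Pred (Fin n) p} (P? : Decidable P) {x} → x ∈ subset P? → P x
∈-subset⁻ P? {x} x∈ with P? x | trans (sym (lookup∘tabulate (does ∘ P?) x)) ([]=⇒lookup x∈)
... | yes px | _ = px
... | no _   | ()

InImage : ∀ {m k} → (Fin m → Fin k) → Subset m → Pred (Fin k) 0ℓ
InImage f Y z = ∃ λ a → f a ≡ z × a ∈ Y

inImage? : ∀ {m k} (f : Fin m → Fin k) Y → Decidable (InImage f Y)
inImage? f Y z = any? (λ a → (f a ≟ᶠ z) ×-dec (a ∈? Y))

image : ∀ {m k} → (Fin m → Fin k) → Subset m → Subset k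
image f Y = subset (inImage? f Y)

∈-image⁺ : ∀ {m k} (f : Fin m → Fin k) {Y a} → a ∈ Y → f a ∈ image f Y
∈-image⁺ f {Y} {a} a∈Y = ∈-subset⁺ (inImage? f Y) (a , refl , a∈Y)

∈-image⁻ : ∀ {m k} (f : Fin m → Fin k) {Y z} → z ∈ image f Y → InImage f Y z
∈-image⁻ f {Y} = ∈-subset⁻ (inImage? f Y)

preimage : ∀ {m k} → (Fin m → Fin k) → Subset k → Subset m
preimage f S = subset (λ v → f v ∈? S)

⁅⁆∪⁅⁆⊆ : ∀ {m} {S : Subset m} {x y} → x ∈ S → y ∈ S → ⁅ x ⁆ ∪ ⁅ y ⁆ ⊆ S
⁅⁆∪⁅⁆⊆ {S = S} {x} {y} x∈S y∈S v∈ with x∈p∪q⁻ ⁅ x ⁆ ⁅ y ⁆ v∈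
... | inj₁ v∈x = subst (_∈ S) (sym (x∈⁅y⁆⇒x≡y x v∈x)) x∈S
... | inj₂ v∈y = subst (_∈ S) (sym (x∈⁅y⁆⇒x≡y y v∈y)) y∈S

SameEdge⇒⊆ : ∀ {m} {S : Subset m} {x y a b} → SameEdge x y a b → x ∈ S → y ∈ S → ⁅ a ⁆ ∪ ⁅ b ⁆ ⊆ S
SameEdge⇒⊆ {S = S} (inj₁ (x≡a , y≡b)) x∈S y∈S = ⁅⁆∪⁅⁆⊆ (subst (_∈ S) x≡a x∈S) (subst (_∈ S) y≡b y∈S)
SameEdge⇒⊆ {S = S} (inj₂ (x≡b , y≡a)) x∈S y∈S = ⁅⁆∪⁅⁆⊆ (subst (_∈ S) y≡a y∈S) (subst (_∈ S) x≡b x∈S)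

partialInverse : ∀ {m k} → (Fin m → Fin k) → Fin k → Maybe (Fin m)
partialInverse f y with any? (λ x → f x ≟ᶠ y)
... | yes (x , _) = just x
... | no _        = nothing

partialInverse-just : ∀ {m k} (f : Fin m → Fin k) y {x} → partialInverse f y ≡ just x → f x ≡ y
partialInverse-just f y eq with any? (λ x → f x ≟ᶠ y)
partialInverse-just f y refl | yes (x , fx≡y) = fx≡y

partialInverse-apply : ∀ {m k} {f : Fin m → Fin k} → Injective _≡_ _≡_ f →
                       ∀ x → partialInverse f (f x) ≡ just x
partialInverse-apply {f = f} f-inj x with any? (λ x' → f x' ≟ᶠ f x)
... | yes (x' , fx'≡fx) = cong just (f-inj fx'≡fx)
... | no miss           = ⊥-elim (miss (x , refl))

-- Walks, connected sets and minors

infixr 5 _++ʷ_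
_++ʷ_ : ∀ {G P a b c} → WalkIn G P a b → WalkIn G P b c → WalkIn G P a c
here _     ++ʷ w′ = w′
step p e w ++ʷ w′ = step p e (w ++ʷ w′)

mapʷ : ∀ {G H : Graph} {P : Fin (n G) → Set} {Q : Fin (n H) → Set} (f : Fin (n G) → Fin (n H)) →
       (∀ {a} → P a → Q (f a)) → f Preserves Adj G ⟶ Adj H →
       ∀ {a b} → WalkIn G P a b → WalkIn H Q (f a) (f b)
mapʷ f pq f-hom (here p)     = here (pq p)
mapʷ f pq f-hom (step p e w) = step (pq p) (f-hom e) (mapʷ f pq f-hom w)

weakenʷ : ∀ {G P Q a b} → (∀ {v} → P v → Q v) → WalkIn G P a b → WalkIn G Q a b
weakenʷ pq = mapʷ id pq id

Connected : (G : Graph) → Subset (n G) → Set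
Connected G Y = ∀ {a b} → a ∈ Y → b ∈ Y → WalkIn G (_∈ Y) a b

Connected-⁅⁆ : ∀ {G} x → Connected G ⁅ x ⁆
Connected-⁅⁆ x a∈ b∈ with x∈⁅y⁆⇒x≡y x a∈ | x∈⁅y⁆⇒x≡y x b∈
... | refl | refl = here a∈

Connected-∪ : ∀ {G X Y x y} → Connected G X → Connected G Y →
              x ∈ X → y ∈ Y → Adj G x y → Connected G (X ∪ Y)
Connected-∪ {G} {X} {Y} X-conn Y-conn x∈X y∈Y x~y a∈ b∈ with x∈p∪q⁻ X Y a∈ | x∈p∪q⁻ X Y b∈
... | inj₁ a∈X | inj₁ b∈X = weakenʷ (p⊆p∪q Y) (X-conn a∈X b∈X)
... | inj₂ a∈Y | inj₂ b∈Y = weakenʷ (q⊆p∪q X Y) (Y-conn a∈Y b∈Y)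
... | inj₁ a∈X | inj₂ b∈Y = weakenʷ (p⊆p∪q Y) (X-conn a∈X x∈X) ++ʷ
                            step (p⊆p∪q Y x∈X) x~y (weakenʷ (q⊆p∪q X Y) (Y-conn y∈Y b∈Y))
... | inj₂ a∈Y | inj₁ b∈X = weakenʷ (q⊆p∪q X Y) (Y-conn a∈Y y∈Y) ++ʷ
                            step (q⊆p∪q X Y y∈Y) (adjSym G x~y) (weakenʷ (p⊆p∪q Y) (X-conn x∈X b∈X))

Connected-image : ∀ {G H : Graph} {Y} (f : Fin (n G) → Fin (n H)) → f Preserves Adj G ⟶ Adj H →
                  Connected G Y → Connected H (image f Y)
Connected-image f f-hom Y-conn a∈ b∈ with ∈-image⁻ f a∈ | ∈-image⁻ f b∈
... | a′ , refl , a′∈Y | b′ , refl , b′∈Y = mapʷ f (∈-image⁺ f) f-hom (Y-conn a′∈Y b′∈Y)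

minor-trans : ∀ {H A B} → H IsMinorOf A → A IsMinorOf B → H IsMinorOf B
minor-trans {H} {A} {B} M₁ M₂ = record
  { β = β ; nonempty = nonempty ; connected = connected ; edges = edges }
  where
  module M₁ = MinorModel M₁
  module M₂ = MinorModel M₂
  β : Fin (n B) → Maybe (Fin (n H))
  β b = M₂.β b >>= M₁.β
  β-via : ∀ {b a h} → M₂.β b ≡ just a → M₁.β a ≡ just h → β b ≡ just h
  β-via eb ea rewrite eb = ea
  β-split : ∀ b {h} → β b ≡ just h → ∃ λ a → M₂.β b ≡ just a × M₁.β a ≡ just h
  β-split b eq with M₂.β b
  ... | just a = a , refl , eq
  nonempty : ∀ h → ∃ λ v → β v ≡ just h
  nonempty h with M₁.nonempty h
  ... | a , ea with M₂.nonempty a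
  ...   | b , eb = b , β-via eb ea
  inBranch : ∀ {a h} → M₁.β a ≡ just h → ∀ {b b′} →
             WalkIn B (λ w → M₂.β w ≡ just a) b b′ → WalkIn B (λ w → β w ≡ just h) b b′
  inBranch ea = weakenʷ (λ eb → β-via eb ea)
  lift : ∀ {h a a′} → WalkIn A (λ w → M₁.β w ≡ just h) a a′ →
         ∀ {b b′} → M₂.β b ≡ just a → M₂.β b′ ≡ just a′ → WalkIn B (λ w → β w ≡ just h) b b′
  lift {a = a} (here ea) eb eb′ = inBranch ea (M₂.connected a _ _ eb eb′)
  lift {a = a} (step ea e w) eb eb′ with M₂.edges _ _ e
  ... | x , y , ex , ey , x~y =
    inBranch ea (M₂.connected a _ _ eb ex) ++ʷ step (β-via ex ea) x~y (lift w ey eb′)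
  connected : ∀ h u v → β u ≡ just h → β v ≡ just h → WalkIn B (λ w → β w ≡ just h) u v
  connected h u v eu ev with β-split u eu | β-split v ev
  ... | a , ua , ah | a′ , va′ , a′h = lift (M₁.connected h a a′ ah a′h) ua va′
  edges : ∀ h h′ → Adj H h h′ → ∃ λ u → ∃ λ v → β u ≡ just h × β v ≡ just h′ × Adj B u v
  edges h h′ e with M₁.edges h h′ e
  ... | a , a′ , ea , ea′ , a~a′ with M₂.edges a a′ a~a′
  ...   | b , b′ , eb , eb′ , b~b′ = b , b′ , β-via eb ea , β-via eb′ ea′ , b~b′

embedding⇒minor : ∀ {H B} (ψ : Fin (n H) → Fin (n B)) → Injective _≡_ _≡_ ψ →
                  ψ Preserves Adj H ⟶ Adj B → H IsMinorOf B
embedding⇒minor {H} {B} ψ ψ-inj ψ-hom = record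
  { β = partialInverse ψ
  ; nonempty = λ h → ψ h , partialInverse-apply ψ-inj h
  ; connected = connected
  ; edges = λ h h′ e → ψ h , ψ h′ , partialInverse-apply ψ-inj h , partialInverse-apply ψ-inj h′ , ψ-hom e
  }
  where
  connected : ∀ h u v → partialInverse ψ u ≡ just h → partialInverse ψ v ≡ just h →
              WalkIn B (λ w → partialInverse ψ w ≡ just h) u v
  connected h u v eu ev with partialInverse-just ψ u eu | partialInverse-just ψ v ev
  ... | refl | refl = here eu

HasK9==-minor : ∀ {A B} → HasK9== A → A IsMinorOf B → HasK9== B
HasK9==-minor (a , b , c , d , a≢b , c≢d , ab≠cd , M) M′ = a , b , c , d , a≢b , c≢d , ab≠cd , minor-trans M M′

addVertex-minor : ∀ {G′ G : Graph} {S′ S} (φ : Fin (n G′) → Fin (n G)) →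
                  Injective _≡_ _≡_ φ → φ Preserves Adj G′ ⟶ Adj G → (∀ {v} → v ∈ S′ → φ v ∈ S) →
                  addVertex G′ S′ IsMinorOf addVertex G S
addVertex-minor {G′} {G} {S′} {S} φ φ-inj φ-hom φ[S′]⊆S =
  embedding⇒minor (zero V.∷ (suc ∘ φ)) (cons-injective (φ-inj ∘ suc-injective) (λ _ ())) (λ {u} {v} → hom {u} {v})
  where
  hom : (zero V.∷ (suc ∘ φ)) Preserves Adj (addVertex G′ S′) ⟶ Adj (addVertex G S)
  hom {zero}  {zero}  ()
  hom {zero}  {suc v} v∈S′ = φ[S′]⊆S v∈S′
  hom {suc v} {zero}  v∈S′ = φ[S′]⊆S v∈S′
  hom {suc u} {suc v} u~v  = φ-hom u~v

module _ (H B : Graph) (β : Fin (n B) → Maybe (Fin (n H))) where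

  Onto : Set
  Onto = ∀ h → ∃ λ v → β v ≡ just h

  CliqueBranches : Set
  CliqueBranches = ∀ h u v → β u ≡ just h → β v ≡ just h → u ≡ v ⊎ Adj B u v

  RealisesEdges : Set
  RealisesEdges = ∀ h h′ → Adj H h h′ → ∃ λ u → ∃ λ v → β u ≡ just h × β v ≡ just h′ × Adj B u v

  cliqueBranches⇒minor : Onto → CliqueBranches → RealisesEdges → H IsMinorOf B
  cliqueBranches⇒minor onto cliques realises = record
    { β = β ; nonempty = onto ; connected = connected ; edges = realises }
    where
    connected : ∀ h u v → β u ≡ just h → β v ≡ just h → WalkIn B (λ w → β w ≡ just h) u v
    connected h u v eu ev with cliques h u v eu ev
    ... | inj₁ refl = here eu
    ... | inj₂ u~v  = step eu u~v (here ev)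

  module _ (H? : ∀ x y → Dec (Adj H x y)) (B? : ∀ x y → Dec (Adj B x y)) where

    private
      _≟ᵐ_ : (a b : Maybe (Fin (n H))) → Dec (a ≡ b)
      _≟ᵐ_ = ≡-dec _≟ᶠ_

    onto? : Dec Onto
    onto? = all? λ h → any? λ v → β v ≟ᵐ just h

    cliqueBranches? : Dec CliqueBranches
    cliqueBranches? = all? λ h → all? λ u → all? λ v →
      (β u ≟ᵐ just h) →-dec ((β v ≟ᵐ just h) →-dec ((u ≟ᶠ v) ⊎-dec B? u v))

    realisesEdges? : Dec RealisesEdges
    realisesEdges? = all? λ h → all? λ h′ → H? h h′ →-dec (any? λ u → any? λ v →
      (β u ≟ᵐ just h) ×-dec ((β v ≟ᵐ just h′) ×-dec B? u v))

-- Isomorphisms, apex minors and dominating branches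

module Isomorphism {G H : Graph} (I : G ≅ H) where
  open _≅_ I

  to : Fin (n G) → Fin (n H)
  to = Inverse.to bij

  from : Fin (n H) → Fin (n G)
  from = Inverse.from bij

  from∘to : ∀ x → from (to x) ≡ x
  from∘to = Inverse.strictlyInverseʳ bij

  to∘from : ∀ y → to (from y) ≡ y
  to∘from = Inverse.strictlyInverseˡ bij

  to-injective : Injective _≡_ _≡_ to
  to-injective {a} {b} eq = trans (sym (from∘to a)) (trans (cong from eq) (from∘to b))

  from-injective : Injective _≡_ _≡_ from
  from-injective {a} {b} eq = trans (sym (to∘from a)) (trans (cong to eq) (to∘from b))

  to-hom : to Preserves Adj G ⟶ Adj H
  to-hom {a} {b} = pres a b

  from-hom : from Preserves Adj H ⟶ Adj G
  from-hom {y} {y′} e = refl' (from y) (from y′) (subst₂ (Adj H) (sym (to∘from y)) (sym (to∘from y′)) e)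

Clique-map : ∀ {G H k} (f : Fin (n G) → Fin (n H)) → Injective _≡_ _≡_ f → f Preserves Adj G ⟶ Adj H →
             Clique G k → Clique H k
Clique-map f f-inj f-hom C = record
  { vtx = f ∘ vtx ; inj = λ i j → inj i j ∘ f-inj ; adj = λ i j i≢j → f-hom (adj i j i≢j) }
  where open Clique C

ApexK9== : Graph → Set
ApexK9== G = ∀ (S : Subset (n G)) (e : Fin 6 → Fin (n G)) →
             Injective _≡_ _≡_ e → (∀ i → e i ∈ S) → HasK9== (addVertex G S)

ApexK9==-pullback : ∀ {G′ G : Graph} (φ : Fin (n G′) → Fin (n G)) →
                    Injective _≡_ _≡_ φ → φ Preserves Adj G′ ⟶ Adj G → ApexK9== G′ →
                    ∀ S (e : Fin 6 → Fin (n G)) → Injective _≡_ _≡_ e → (∀ i → e i ∈ S) →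
                    (∀ i → ∃ λ v → φ v ≡ e i) → HasK9== (addVertex G S)
ApexK9==-pullback {G′} φ φ-inj φ-hom apex S e e-inj e∈S e⊆φ =
  HasK9==-minor (apex (preimage φ S) e′ e′-inj e′∈)
                (addVertex-minor φ φ-inj φ-hom (∈-subset⁻ (λ v → φ v ∈? S)))
  where
  e′ : Fin 6 → Fin (n G′)
  e′ = proj₁ ∘ e⊆φ
  e′-inj : Injective _≡_ _≡_ e′
  e′-inj {a} {b} eq = e-inj (trans (sym (proj₂ (e⊆φ a))) (trans (cong φ eq) (proj₂ (e⊆φ b))))
  e′∈ : ∀ i → e′ i ∈ preimage φ S
  e′∈ i = ∈-subset⁺ (λ v → φ v ∈? S) (subst (_∈ S) (sym (proj₂ (e⊆φ i))) (e∈S i))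

ApexK9==-≅ : ∀ {G H} → G ≅ H → ApexK9== H → ApexK9== G
ApexK9==-≅ I apex S e e-inj e∈S =
  ApexK9==-pullback from from-injective from-hom apex S e e-inj e∈S (λ i → to (e i) , from∘to (e i))
  where open Isomorphism I

record DominatingBranch {k} (G : Graph) (C : Clique G k) (x : Fin (n G)) : Set where
  field
    Y         : Subset (n G)
    x∈Y       : x ∈ Y
    connected : Connected G Y
    avoids    : ∀ i → Clique.vtx C i ∉ Y
    dominates : ∀ i → ∃ λ y → y ∈ Y × Adj G y (Clique.vtx C i)

CliqueDominable : Graph → ℕ → Set
CliqueDominable G k = ∀ (C : Clique G k) x → (∀ i → Clique.vtx C i ≢ x) → DominatingBranch G C x

DominatingBranch-image : ∀ {G′ G : Graph} {k} {D : Clique G k} {x}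
  (φ : Fin (n G′) → Fin (n G)) → φ Preserves Adj G′ ⟶ Adj G →
  ∀ {Y x′} → Connected G′ Y → x′ ∈ Y → φ x′ ≡ x →
  (∀ {a} i → a ∈ Y → φ a ≢ Clique.vtx D i) →
  (∀ i → ∃ λ y → y ∈ Y × Adj G (φ y) (Clique.vtx D i)) →
  DominatingBranch G D x
DominatingBranch-image φ φ-hom {Y} Y-conn x′∈Y refl avoids dominates = record
  { Y         = image φ Y
  ; x∈Y       = ∈-image⁺ φ x′∈Y
  ; connected = Connected-image φ φ-hom Y-conn
  ; avoids    = λ i d∈ → let (a , φa≡d , a∈Y) = ∈-image⁻ φ d∈ in avoids i a∈Y φa≡d
  ; dominates = λ i → let (y , y∈Y , y~d) = dominates i in φ y , ∈-image⁺ φ y∈Y , y~d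
  }

CliqueDominable-≅ : ∀ {G H k} → G ≅ H → CliqueDominable H k → CliqueDominable G k
CliqueDominable-≅ {G} {H} I dom C x x∉C =
  DominatingBranch-image from from-hom connected x∈Y (from∘to x)
    (λ i a∈Y eq → avoids i (subst (_∈ Y) (trans (sym (to∘from _)) (cong to eq)) a∈Y))
    (λ i → let (y , y∈Y , y~d) = dominates i in
           y , y∈Y , subst (Adj G (from y)) (from∘to (Clique.vtx C i)) (from-hom y~d))
  where
  open Isomorphism I
  open DominatingBranch (dom (Clique-map to to-injective to-hom C) (to x) (λ i → x∉C i ∘ to-injective))

-- The base graphs K₈ and K₂,₂,₂,₂,₂

CliqueDominable-K : ∀ m k → CliqueDominable (K m) k
CliqueDominable-K m k C x x∉C = record
  { Y         = ⁅ x ⁆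
  ; x∈Y       = x∈⁅x⁆ x
  ; connected = Connected-⁅⁆ x
  ; avoids    = λ i d∈ → x∉C i (x∈⁅y⁆⇒x≡y x d∈)
  ; dominates = λ i → x , x∈⁅x⁆ x , λ x≡d → x∉C i (sym x≡d)
  }

K9==-apexOverK8 : ∀ S (E : Fin 8 → Fin 8) → Injective _≡_ _≡_ E → (∀ k → E (suc (suc k)) ∈ S) →
                  HasK9== (addVertex (K 8) S)
K9==-apexOverK8 S E E-inj E∈S =
  # 0 , # 1 , # 0 , # 2 , (λ ()) , (λ ()) , (λ { (inj₁ (_ , ())) ; (inj₂ (() , _)) }) ,
  embedding⇒minor ψ (cons-injective (E-inj ∘ suc-injective) (λ _ ())) (λ {h} {h′} → ψ-hom {h} {h′})
  where
  ψ : Fin 9 → Fin 9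
  ψ = zero V.∷ (suc ∘ E)
  ψ-hom : ψ Preserves Adj (K9minus (# 0) (# 1) (# 0) (# 2)) ⟶ Adj (addVertex (K 8) S)
  ψ-hom {zero}              {zero}              (x≢x , _)     = ⊥-elim (x≢x refl)
  ψ-hom {zero}              {suc zero}          (_ , ≠01 , _) = ⊥-elim (≠01 (inj₁ (refl , refl)))
  ψ-hom {zero}              {suc (suc zero)}    (_ , _ , ≠02) = ⊥-elim (≠02 (inj₁ (refl , refl)))
  ψ-hom {zero}              {suc (suc (suc k))} _             = E∈S k
  ψ-hom {suc zero}          {zero}              (_ , ≠01 , _) = ⊥-elim (≠01 (inj₂ (refl , refl)))
  ψ-hom {suc (suc zero)}    {zero}              (_ , _ , ≠02) = ⊥-elim (≠02 (inj₂ (refl , refl)))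
  ψ-hom {suc (suc (suc k))} {zero}              _             = E∈S k
  ψ-hom {suc a}             {suc b}             (a≢b , _)     = a≢b ∘ cong suc ∘ E-inj

ApexK9==-K8 : ApexK9== (K 8)
ApexK9==-K8 S e e-inj e∈S with extendInjection e-inj (m<n⇒m<1+n (n<1+n 6))
... | a₇ , inj₇ with extendInjection inj₇ (n<1+n 7)
...   | a₈ , inj₈ = K9==-apexOverK8 S (a₈ V.∷ a₇ V.∷ e) inj₈ e∈S

sameEdge? : ∀ {m} (x y a b : Fin m) → Dec (SameEdge x y a b)
sameEdge? x y a b = ((x ≟ᶠ a) ×-dec (y ≟ᶠ b)) ⊎-dec ((x ≟ᶠ b) ×-dec (y ≟ᶠ a))

K9minus-adj? : ∀ a b c d x y → Dec (Adj (K9minus a b c d) x y)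
K9minus-adj? a b c d x y = ¬? (x ≟ᶠ y) ×-dec (¬? (sameEdge? x y a b) ×-dec ¬? (sameEdge? x y c d))

K22222-adj? : ∀ x y → Dec (Adj K22222 x y)
K22222-adj? x y = ¬? (part x ≟ℕ part y)

addVertex-adj? : ∀ G S → (∀ x y → Dec (Adj G x y)) → ∀ x y → Dec (Adj (addVertex G S) x y)
addVertex-adj? G S G? zero    zero    = no (λ ())
addVertex-adj? G S G? zero    (suc y) = y ∈? S
addVertex-adj? G S G? (suc x) zero    = x ∈? S
addVertex-adj? G S G? (suc x) (suc y) = G? x y

partIndex : Fin 10 → Fin 5
partIndex = quotient {5} 2

lo hi : Fin 5 → Fin 10
lo q = combine {n = 2} q zero
hi q = combine {n = 2} q (suc zero)

pair : Fin 5 → Subset 10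
pair q = ⁅ lo q ⁆ ∪ ⁅ hi q ⁆

part≡partIndex : ∀ x → part x ≡ toℕ (partIndex x)
part≡partIndex = toWitness {a? = all? λ x → part x ≟ℕ toℕ (partIndex x)} _

partIndex-lo : ∀ q → partIndex (lo q) ≡ q
partIndex-lo = toWitness {a? = all? λ q → partIndex (lo q) ≟ᶠ q} _

partIndex-hi : ∀ q → partIndex (hi q) ≡ q
partIndex-hi = toWitness {a? = all? λ q → partIndex (hi q) ≟ᶠ q} _

lo≢hi : ∀ q → lo q ≢ hi q
lo≢hi = toWitness {a? = all? λ q → ¬? (lo q ≟ᶠ hi q)} _

samePart⇒pair : ∀ x y → x ≢ y → partIndex x ≡ partIndex y →
                SameEdge x y (lo (partIndex x)) (hi (partIndex x))
samePart⇒pair = toWitness {a? = all? λ x → all? λ y →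
  ¬? (x ≟ᶠ y) →-dec ((partIndex x ≟ᶠ partIndex y) →-dec sameEdge? x y (lo (partIndex x)) (hi (partIndex x)))} _

K22222-adj⁺ : ∀ {x y} → partIndex x ≢ partIndex y → Adj K22222 x y
K22222-adj⁺ {x} {y} ≢ eq =
  ≢ (toℕ-injective (trans (sym (part≡partIndex x)) (trans eq (part≡partIndex y))))

K22222-adj⁻ : ∀ {x y} → Adj K22222 x y → partIndex x ≢ partIndex y
K22222-adj⁻ {x} {y} x~y eq =
  x~y (trans (part≡partIndex x) (trans (cong toℕ eq) (sym (part≡partIndex y))))

∃-outsideClique : ∀ {k} (C : Clique K22222 k) q → ∃ λ y → (∀ i → Clique.vtx C i ≢ y) × partIndex y ≡ q
∃-outsideClique C q with any? (λ i → Clique.vtx C i ≟ᶠ lo q)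
... | no lo∉C       = lo q , (λ i eq → lo∉C (i , eq)) , partIndex-lo q
... | yes (i , i↦lo) = hi q , hi∉C , partIndex-hi q
  where
  open Clique C
  hi∉C : ∀ j → vtx j ≢ hi q
  hi∉C j j↦hi with i ≟ᶠ j
  ... | yes refl = lo≢hi q (trans (sym i↦lo) j↦hi)
  ... | no i≢j   = K22222-adj⁻ {vtx i} {vtx j} (adj i j i≢j) (begin
    partIndex (vtx i) ≡⟨ cong partIndex i↦lo ⟩
    partIndex (lo q)  ≡⟨ partIndex-lo q ⟩
    q                 ≡⟨ partIndex-hi q ⟨
    partIndex (hi q)  ≡⟨ cong partIndex j↦hi ⟨
    partIndex (vtx j) ∎)
    where open ≡-Reasoning

CliqueDominable-K22222 : ∀ k → CliqueDominable K22222 k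
CliqueDominable-K22222 k C x x∉C with ∃-outsideClique C (punchIn (partIndex x) zero)
... | y , y∉C , y-part = record
  { Y         = ⁅ x ⁆ ∪ ⁅ y ⁆
  ; x∈Y       = x∈Y
  ; connected = Connected-∪ (Connected-⁅⁆ x) (Connected-⁅⁆ y) (x∈⁅x⁆ x) (x∈⁅x⁆ y)
                            (K22222-adj⁺ {x} {y} (λ eq → y∉part (sym eq)))
  ; avoids    = avoids
  ; dominates = dominates
  }
  where
  open Clique C
  y∉part : partIndex y ≢ partIndex x
  y∉part eq = punchInᵢ≢i (partIndex x) zero (trans (sym y-part) eq)
  x∈Y : x ∈ ⁅ x ⁆ ∪ ⁅ y ⁆
  x∈Y = x∈p∪q⁺ (inj₁ (x∈⁅x⁆ x))
  y∈Y : y ∈ ⁅ x ⁆ ∪ ⁅ y ⁆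
  y∈Y = x∈p∪q⁺ (inj₂ (x∈⁅x⁆ y))
  avoids : ∀ i → vtx i ∉ ⁅ x ⁆ ∪ ⁅ y ⁆
  avoids i d∈ with x∈p∪q⁻ ⁅ x ⁆ ⁅ y ⁆ d∈
  ... | inj₁ d∈x = x∉C i (x∈⁅y⁆⇒x≡y x d∈x)
  ... | inj₂ d∈y = y∉C i (x∈⁅y⁆⇒x≡y y d∈y)
  dominates : ∀ i → ∃ λ z → z ∈ ⁅ x ⁆ ∪ ⁅ y ⁆ × Adj K22222 z (vtx i)
  dominates i with partIndex (vtx i) ≟ᶠ partIndex x
  ... | no ≢x  = x , x∈Y , K22222-adj⁺ {x} {vtx i} (λ eq → ≢x (sym eq))
  ... | yes ≡x = y , y∈Y , K22222-adj⁺ {y} {vtx i} (λ eq → y∉part (trans eq ≡x))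

-- Row p lists the branch of the apex and then of the vertices 0 … 9.  The apex and lo p form
-- branch 0 and hi p is branch 2; of the other parts q₁ < q₂ < q₃ < q₄, the vertices lo q₁, lo q₂
-- together form branch 1, hi q₁ and hi q₂ are branches 3 and 4, and q₃, q₄ give the two
-- non-edges 56 and 78.
branches : Fin 5 → Vec (Fin 9) 11
branches zero                         = # 0 ∷ # 0 ∷ # 2 ∷ # 1 ∷ # 3 ∷ # 1 ∷ # 4 ∷ # 5 ∷ # 6 ∷ # 7 ∷ # 8 ∷ []
branches (suc zero)                   = # 0 ∷ # 1 ∷ # 3 ∷ # 0 ∷ # 2 ∷ # 1 ∷ # 4 ∷ # 5 ∷ # 6 ∷ # 7 ∷ # 8 ∷ []
branches (suc (suc zero))             = # 0 ∷ # 1 ∷ # 3 ∷ # 1 ∷ # 4 ∷ # 0 ∷ # 2 ∷ # 5 ∷ # 6 ∷ # 7 ∷ # 8 ∷ []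
branches (suc (suc (suc zero)))       = # 0 ∷ # 1 ∷ # 3 ∷ # 1 ∷ # 4 ∷ # 5 ∷ # 6 ∷ # 0 ∷ # 2 ∷ # 7 ∷ # 8 ∷ []
branches (suc (suc (suc (suc zero)))) = # 0 ∷ # 1 ∷ # 3 ∷ # 1 ∷ # 4 ∷ # 5 ∷ # 6 ∷ # 7 ∷ # 8 ∷ # 0 ∷ # 2 ∷ []

module PairApex (p : Fin 5) where

  H B : Graph
  H = K9minus (# 5) (# 6) (# 7) (# 8)
  B = addVertex K22222 (pair p)

  β : Fin 11 → Maybe (Fin 9)
  β = just ∘ lookup (branches p)

  H? : ∀ x y → Dec (Adj H x y)
  H? = K9minus-adj? (# 5) (# 6) (# 7) (# 8)

  B? : ∀ x y → Dec (Adj B x y)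
  B? = addVertex-adj? K22222 (pair p) K22222-adj?

  minor : True (onto? H B β H? B?) → True (cliqueBranches? H B β H? B?) → True (realisesEdges? H B β H? B?) →
          H IsMinorOf B
  minor onto cliques realises =
    cliqueBranches⇒minor H B β (toWitness onto) (toWitness cliques) (toWitness realises)

pairApex-minor : ∀ p → K9minus (# 5) (# 6) (# 7) (# 8) IsMinorOf addVertex K22222 (pair p)
pairApex-minor zero                         = PairApex.minor zero _ _ _
pairApex-minor (suc zero)                   = PairApex.minor (suc zero) _ _ _
pairApex-minor (suc (suc zero))             = PairApex.minor (suc (suc zero)) _ _ _
pairApex-minor (suc (suc (suc zero)))       = PairApex.minor (suc (suc (suc zero))) _ _ _
pairApex-minor (suc (suc (suc (suc zero)))) = PairApex.minor (suc (suc (suc (suc zero)))) _ _ _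

ApexK9==-K22222 : ApexK9== K22222
ApexK9==-K22222 S e e-inj e∈S with pigeonhole (n<1+n 5) (partIndex ∘ e)
... | i , j , i<j , samePart =
  HasK9==-minor (# 5 , # 6 , # 7 , # 8 , (λ ()) , (λ ()) , (λ { (inj₁ (() , _)) ; (inj₂ (() , _)) }) ,
                 pairApex-minor (partIndex (e i)))
                (addVertex-minor id id id (SameEdge⇒⊆ eᵢeⱼ-isPair (e∈S i) (e∈S j)))
  where
  eᵢeⱼ-isPair : SameEdge (e i) (e j) (lo (partIndex (e i))) (hi (partIndex (e i)))
  eᵢeⱼ-isPair = samePart⇒pair (e i) (e j) (<⇒≢ i<j ∘ e-inj) samePart

-- Clique sums

module Gluing {k G₁ G₂ C₁ C₂ G} (gl : IsGluing k G₁ G₂ C₁ C₂ G) where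
  open IsGluing gl public renaming (glue to glued)

  swap : IsGluing k G₂ G₁ C₂ C₁ G
  swap = record
    { φ₁ = φ₂ ; φ₂ = φ₁ ; inj₁' = inj₂' ; inj₂' = inj₁' ; cover = Sum.swap ∘ cover
    ; glue = sym ∘ glued
    ; onlyGlue = λ u v eq → let (i , v≡ , u≡) = onlyGlue v u (sym eq) in i , u≡ , v≡
    ; adjFrom = λ x y x~y → Sum.swap (adjFrom x y x~y) ; adjTo₁ = adjTo₂ ; adjTo₂ = adjTo₁ }

  φ₁-injective : Injective _≡_ _≡_ φ₁
  φ₁-injective = inj₁' _ _

  φ₂-injective : Injective _≡_ _≡_ φ₂
  φ₂-injective = inj₂' _ _

  φ₁-hom : φ₁ Preserves Adj G₁ ⟶ Adj G
  φ₁-hom = adjTo₁ _ _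

  φ₂-hom : φ₂ Preserves Adj G₂ ⟶ Adj G
  φ₂-hom = adjTo₂ _ _

  -- Two vertices of G₁ whose images are adjacent only through G₂ are both glued, so they lie
  -- in the clique C₁.
  φ₁-reflects : ∀ {a b} → Adj G (φ₁ a) (φ₁ b) → Adj G₁ a b
  φ₁-reflects {a} {b} φa~φb with adjFrom (φ₁ a) (φ₁ b) φa~φb
  ... | inj₁ (u , u′ , φu≡ , φu′≡ , u~u′) = subst₂ (Adj G₁) (φ₁-injective φu≡) (φ₁-injective φu′≡) u~u′
  ... | inj₂ (v , v′ , φv≡ , φv′≡ , _) with onlyGlue a v (sym φv≡) | onlyGlue b v′ (sym φv′≡)
  ...   | i , refl , _ | j , refl , _ with i ≟ᶠ j
  ...     | yes refl = ⊥-elim (irrefl G φa~φb)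
  ...     | no i≢j   = Clique.adj C₁ i j i≢j

  branch₂-avoids-φ₁ : ∀ {w a u} (B : DominatingBranch G₂ C₂ w) → a ∈ DominatingBranch.Y B → φ₂ a ≢ φ₁ u
  branch₂-avoids-φ₁ {a = a} {u = u} B a∈Y eq with onlyGlue u a (sym eq)
  ... | i , _ , refl = DominatingBranch.avoids B i a∈Y

  onlyOnSide₁ : ∀ x → ¬ (∃ λ v → φ₂ v ≡ x) → ∃ λ u → φ₁ u ≡ x × (∀ i → Clique.vtx C₁ i ≢ u)
  onlyOnSide₁ x x∉φ₂ with cover x
  ... | inj₂ x∈φ₂          = ⊥-elim (x∉φ₂ x∈φ₂)
  ... | inj₁ (u , φ₁u≡x) = u , φ₁u≡x , λ i C₁i≡u →
    x∉φ₂ (Clique.vtx C₂ i , trans (sym (glued i)) (trans (cong φ₁ C₁i≡u) φ₁u≡x))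

  -- Two clique vertices on different sides only are not adjacent in G.
  clique-side : ∀ {m} (D : Clique G m) →
                (∀ i → ∃ λ u → φ₁ u ≡ Clique.vtx D i) ⊎ (∀ i → ∃ λ v → φ₂ v ≡ Clique.vtx D i)
  clique-side D with all? (λ i → any? (λ u → φ₁ u ≟ᶠ Clique.vtx D i))
  ... | yes D⊆φ₁ = inj₁ D⊆φ₁
  ... | no D⊈φ₁ with ¬∀⟶∃¬ _ _ (λ i → any? (λ u → φ₁ u ≟ᶠ Clique.vtx D i)) D⊈φ₁
  ...   | i , Di∉φ₁ = inj₂ D⊆φ₂
    where
    D⊆φ₂ : ∀ j → ∃ λ v → φ₂ v ≡ Clique.vtx D j
    D⊆φ₂ j with i ≟ᶠ j
    ... | yes refl = [ (λ Di∈φ₁ → ⊥-elim (Di∉φ₁ Di∈φ₁)) , id ]′ (cover (Clique.vtx D i))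
    ... | no i≢j with adjFrom _ _ (Clique.adj D i j i≢j)
    ...   | inj₁ (u , _ , φ₁u≡Di , _) = ⊥-elim (Di∉φ₁ (u , φ₁u≡Di))
    ...   | inj₂ (_ , v′ , _ , φ₂v′≡Dj , _) = v′ , φ₂v′≡Dj

  preimageClique : ∀ {m} (D : Clique G m) → (∀ i → ∃ λ u → φ₁ u ≡ Clique.vtx D i) → Clique G₁ m
  preimageClique D D⊆φ₁ = record
    { vtx = proj₁ ∘ D⊆φ₁
    ; inj = λ i j eq → Clique.inj D i j (trans (sym (proj₂ (D⊆φ₁ i))) (trans (cong φ₁ eq) (proj₂ (D⊆φ₁ j))))
    ; adj = λ i j i≢j → φ₁-reflects (subst₂ (Adj G) (sym (proj₂ (D⊆φ₁ i))) (sym (proj₂ (D⊆φ₁ j)))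
                                             (Clique.adj D i j i≢j))
    }

module Domination {k G₁ G₂ C₁ C₂ G} (gl : IsGluing k G₁ G₂ C₁ C₂ G)
                  (dom₁ : CliqueDominable G₁ k) (dom₂ : CliqueDominable G₂ k)
                  (D : Clique G k) (D⊆φ₁ : ∀ i → ∃ λ u → IsGluing.φ₁ gl u ≡ Clique.vtx D i) where
  open Gluing gl
  open Clique D
  open DominatingBranch

  D₁ : Clique G₁ k
  D₁ = preimageClique D D⊆φ₁

  φ₁D₁ : ∀ i → φ₁ (Clique.vtx D₁ i) ≡ vtx i
  φ₁D₁ i = proj₂ (D⊆φ₁ i)

  branch₁-image-avoids : ∀ {u a} (B : DominatingBranch G₁ D₁ u) i → a ∈ Y B → φ₁ a ≢ vtx i
  branch₁-image-avoids B i a∈Y φ₁a≡Di =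
    avoids B i (subst (_∈ Y B) (φ₁-injective (trans φ₁a≡Di (sym (φ₁D₁ i)))) a∈Y)

  branch₁-image-dominates : ∀ {u} (B : DominatingBranch G₁ D₁ u) i → ∃ λ y → y ∈ Y B × Adj G (φ₁ y) (vtx i)
  branch₁-image-dominates B i with dominates B i
  ... | y , y∈Y , y~D₁i = y , y∈Y , subst (Adj G (φ₁ y)) (φ₁D₁ i) (φ₁-hom y~D₁i)

  branch₁ : ∀ u → (∀ i → φ₁ u ≢ vtx i) → DominatingBranch G₁ D₁ u
  branch₁ u φ₁u∉D = dom₁ D₁ u (λ i D₁i≡u → φ₁u∉D i (trans (cong φ₁ (sym D₁i≡u)) (φ₁D₁ i)))

  fromSide₁ : ∀ {x u} → φ₁ u ≡ x → (∀ i → vtx i ≢ x) → DominatingBranch G D x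
  fromSide₁ {x} {u} φ₁u≡x x∉D =
    DominatingBranch-image φ₁ φ₁-hom (connected B) (x∈Y B) φ₁u≡x (branch₁-image-avoids B) (branch₁-image-dominates B)
    where
    B : DominatingBranch G₁ D₁ u
    B = branch₁ u (λ i eq → x∉D i (trans (sym eq) φ₁u≡x))

  module _ {x w} (φ₂w≡x : φ₂ w ≡ x) (B₂ : DominatingBranch G₂ C₂ w) where

    withinGlue : (∀ i → ∃ λ j → φ₁ (Clique.vtx C₁ j) ≡ vtx i) → DominatingBranch G D x
    withinGlue D⊆C₁ = DominatingBranch-image φ₂ φ₂-hom (connected B₂) (x∈Y B₂) φ₂w≡x avoidsD dominatesD
      where
      avoidsD : ∀ {a} i → a ∈ Y B₂ → φ₂ a ≢ vtx i
      avoidsD i a∈Y φ₂a≡Di = branch₂-avoids-φ₁ B₂ a∈Y (trans φ₂a≡Di (sym (proj₂ (D⊆C₁ i))))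
      dominatesD : ∀ i → ∃ λ y → y ∈ Y B₂ × Adj G (φ₂ y) (vtx i)
      dominatesD i with D⊆C₁ i
      ... | j , C₁j↦Di with dominates B₂ j
      ...   | y , y∈Y , y~C₂j = y , y∈Y , subst (Adj G (φ₂ y)) (trans (sym (glued j)) C₁j↦Di) (φ₂-hom y~C₂j)

    -- A glued vertex c outside D is dominated by B₂ and carries a branch for D in G₁; the union
    -- of the two images is connected through the edge from B₂ to c.
    throughGlue : ∀ j → (∀ i → φ₁ (Clique.vtx C₁ j) ≢ vtx i) → DominatingBranch G D x
    throughGlue j c∉D with dominates B₂ j
    ... | y , y∈Y₂ , y~C₂j = record
      { Y         = image φ₂ (Y B₂) ∪ image φ₁ (Y B₁)
      ; x∈Y       = x∈p∪q⁺ (inj₁ (subst (_∈ image φ₂ (Y B₂)) φ₂w≡x (∈-image⁺ φ₂ (x∈Y B₂))))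
      ; connected = Connected-∪ (Connected-image φ₂ φ₂-hom (connected B₂)) (Connected-image φ₁ φ₁-hom (connected B₁))
                                (∈-image⁺ φ₂ y∈Y₂) (∈-image⁺ φ₁ (x∈Y B₁))
                                (subst (Adj G (φ₂ y)) (sym (glued j)) (φ₂-hom y~C₂j))
      ; avoids    = avoidsD
      ; dominates = dominatesD
      }
      where
      B₁ : DominatingBranch G₁ D₁ (Clique.vtx C₁ j)
      B₁ = branch₁ (Clique.vtx C₁ j) c∉D
      avoidsD : ∀ i → vtx i ∉ image φ₂ (Y B₂) ∪ image φ₁ (Y B₁)
      avoidsD i Di∈ with x∈p∪q⁻ (image φ₂ (Y B₂)) (image φ₁ (Y B₁)) Di∈
      ... | inj₁ Di∈₂ = let (a , φ₂a≡Di , a∈Y) = ∈-image⁻ φ₂ Di∈₂ in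
                        branch₂-avoids-φ₁ B₂ a∈Y (trans φ₂a≡Di (sym (φ₁D₁ i)))
      ... | inj₂ Di∈₁ = let (a , φ₁a≡Di , a∈Y) = ∈-image⁻ φ₁ Di∈₁ in branch₁-image-avoids B₁ i a∈Y φ₁a≡Di
      dominatesD : ∀ i → ∃ λ z → z ∈ image φ₂ (Y B₂) ∪ image φ₁ (Y B₁) × Adj G z (vtx i)
      dominatesD i with branch₁-image-dominates B₁ i
      ... | z , z∈Y , z~Di = φ₁ z , x∈p∪q⁺ (inj₂ (∈-image⁺ φ₁ z∈Y)) , z~Di

  dominatingBranch : ∀ x → (∀ i → vtx i ≢ x) → DominatingBranch G D x
  dominatingBranch x x∉D with any? (λ u → φ₁ u ≟ᶠ x)
  ... | yes (u , φ₁u≡x) = fromSide₁ φ₁u≡x x∉D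
  ... | no x∉φ₁ with Gluing.onlyOnSide₁ swap x x∉φ₁
  ...   | w , φ₂w≡x , w∉C₂ with all? (λ j → any? (λ i → vtx i ≟ᶠ φ₁ (Clique.vtx C₁ j)))
  ...     | yes C₁⊆D = withinGlue φ₂w≡x (dom₂ C₂ w w∉C₂)
                                    (injective-⊆⇒⊇ (Clique.inj C₁ _ _ ∘ φ₁-injective) C₁⊆D)
  ...     | no C₁⊈D with ¬∀⟶∃¬ _ _ (λ j → any? (λ i → vtx i ≟ᶠ φ₁ (Clique.vtx C₁ j))) C₁⊈D
  ...       | j , c∉D = throughGlue φ₂w≡x (dom₂ C₂ w w∉C₂) j (λ i eq → c∉D (i , sym eq))

CliqueDominable-glue : ∀ {k G₁ G₂ C₁ C₂ G} → IsGluing k G₁ G₂ C₁ C₂ G →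
                       CliqueDominable G₁ k → CliqueDominable G₂ k → CliqueDominable G k
CliqueDominable-glue gl dom₁ dom₂ D x x∉D with Gluing.clique-side gl D
... | inj₁ D⊆φ₁ = Domination.dominatingBranch gl dom₁ dom₂ D D⊆φ₁ x x∉D
... | inj₂ D⊆φ₂ = Domination.dominatingBranch (Gluing.swap gl) dom₂ dom₁ D D⊆φ₂ x x∉D

branchOf : ∀ {m} {A : Set} → Maybe (Fin m) → Dec A → Maybe (Fin (suc m))
branchOf (just u) _       = just (suc u)
branchOf nothing  (yes _) = just zero
branchOf nothing  (no _)  = nothing

-- The apex of G + S absorbs the image of a dominating branch of C₂ meeting S; every other
-- branch set is a single vertex of G₁.
module Absorption {k G₁ G₂ C₁ C₂ G} (gl : IsGluing k G₁ G₂ C₁ C₂ G) {S : Subset (n G)} {w}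
                  (B₂ : DominatingBranch G₂ C₂ w) (w∈S : IsGluing.φ₂ gl w ∈ S) where
  open Gluing gl
  open DominatingBranch B₂

  T : Subset (n G₁)
  T = preimage φ₁ S ∪ image (Clique.vtx C₁) ⊤

  β : Fin (suc (n G)) → Maybe (Fin (suc (n G₁)))
  β zero    = just zero
  β (suc z) = branchOf (partialInverse φ₁ z) (z ∈? image φ₂ Y)

  β-φ₁ : ∀ u → β (suc (φ₁ u)) ≡ just (suc u)
  β-φ₁ u rewrite partialInverse-apply φ₁-injective u = refl

  β-Y : ∀ {a} → a ∈ Y → β (suc (φ₂ a)) ≡ just zero
  β-Y {a} a∈Y with partialInverse φ₁ (φ₂ a) in eq
  ... | just u  = ⊥-elim (branch₂-avoids-φ₁ B₂ a∈Y (sym (partialInverse-just φ₁ _ eq)))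
  ... | nothing with φ₂ a ∈? image φ₂ Y
  ...   | yes _   = refl
  ...   | no φ₂a∉ = ⊥-elim (φ₂a∉ (∈-image⁺ φ₂ a∈Y))

  β⁻¹-suc : ∀ b {u} → β b ≡ just (suc u) → b ≡ suc (φ₁ u)
  β⁻¹-suc zero ()
  β⁻¹-suc (suc z) eq with partialInverse φ₁ z in eq′ | z ∈? image φ₂ Y
  β⁻¹-suc (suc z) refl | just u  | _     = cong suc (sym (partialInverse-just φ₁ z eq′))
  β⁻¹-suc (suc z) ()   | nothing | yes _
  β⁻¹-suc (suc z) ()   | nothing | no _

  β⁻¹-zero : ∀ b → β b ≡ just zero → b ≡ zero ⊎ ∃ λ a → b ≡ suc (φ₂ a) × a ∈ Y
  β⁻¹-zero zero    _  = inj₁ refl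
  β⁻¹-zero (suc z) eq with partialInverse φ₁ z | z ∈? image φ₂ Y
  β⁻¹-zero (suc z) () | just _  | _
  β⁻¹-zero (suc z) _  | nothing | yes z∈ with ∈-image⁻ φ₂ z∈
  ... | a , φ₂a≡z , a∈Y = inj₂ (a , cong suc (sym φ₂a≡z) , a∈Y)
  β⁻¹-zero (suc z) () | nothing | no _

  private
    B : Graph
    B = addVertex G S

    InApex : Fin (suc (n G)) → Set
    InApex b = β b ≡ just zero

  walkY : ∀ {a a′} → WalkIn G₂ (_∈ Y) a a′ → WalkIn B InApex (suc (φ₂ a)) (suc (φ₂ a′))
  walkY = mapʷ (suc ∘ φ₂) β-Y φ₂-hom

  toApex : ∀ b → InApex b → WalkIn B InApex b zero
  toApex b eb with β⁻¹-zero b eb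
  ... | inj₁ refl              = here eb
  ... | inj₂ (a , refl , a∈Y) = walkY (connected a∈Y x∈Y) ++ʷ step (β-Y x∈Y) w∈S (here refl)

  fromApex : ∀ b → InApex b → WalkIn B InApex zero b
  fromApex b eb with β⁻¹-zero b eb
  ... | inj₁ refl              = here eb
  ... | inj₂ (a , refl , a∈Y) = step refl w∈S (walkY (connected x∈Y a∈Y))

  branchConnected : ∀ h b b′ → β b ≡ just h → β b′ ≡ just h → WalkIn B (λ z → β z ≡ just h) b b′
  branchConnected zero    b b′ eb eb′ = toApex b eb ++ʷ fromApex b′ eb′
  branchConnected (suc u) b b′ eb eb′ with β⁻¹-suc b eb | β⁻¹-suc b′ eb′
  ... | refl | refl = here eb

  apexEdge : ∀ u → u ∈ T → ∃ λ b → ∃ λ b′ → InApex b × β b′ ≡ just (suc u) × Adj B b b′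
  apexEdge u u∈T with x∈p∪q⁻ (preimage φ₁ S) (image (Clique.vtx C₁) ⊤) u∈T
  ... | inj₁ u∈φ₁⁻¹S = zero , suc (φ₁ u) , refl , β-φ₁ u , ∈-subset⁻ (λ v → φ₁ v ∈? S) u∈φ₁⁻¹S
  ... | inj₂ u∈C₁ with ∈-image⁻ (Clique.vtx C₁) u∈C₁
  ...   | i , refl , _ with dominates i
  ...     | y , y∈Y , y~C₂i =
    suc (φ₂ y) , suc (φ₁ (Clique.vtx C₁ i)) , β-Y y∈Y , β-φ₁ _ , subst (Adj G (φ₂ y)) (sym (glued i)) (φ₂-hom y~C₂i)

  edges : ∀ h h′ → Adj (addVertex G₁ T) h h′ → ∃ λ b → ∃ λ b′ → β b ≡ just h × β b′ ≡ just h′ × Adj B b b′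
  edges zero    zero     ()
  edges zero    (suc u)  u∈T = apexEdge u u∈T
  edges (suc u) zero     u∈T with apexEdge u u∈T
  ... | b , b′ , eb , eb′ , b~b′ = b′ , b , eb′ , eb , adjSym B {b} {b′} b~b′
  edges (suc u) (suc u′) u~u′ = suc (φ₁ u) , suc (φ₁ u′) , β-φ₁ u , β-φ₁ u′ , φ₁-hom u~u′

  minor : addVertex G₁ T IsMinorOf addVertex G S
  minor = record
    { β         = β
    ; nonempty  = λ { zero → zero , refl ; (suc u) → suc (φ₁ u) , β-φ₁ u }
    ; connected = branchConnected
    ; edges     = edges
    }

module _ {G₁ G₂ C₁ C₂ G} (gl : IsGluing 5 G₁ G₂ C₁ C₂ G)
         (apex₁ : ApexK9== G₁) (dom₂ : CliqueDominable G₂ 5) where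
  open Gluing gl

  -- If the apex sees x only in G₁ and y only in G₂, contracting a branch of C₂ at y into the
  -- apex gives G₁ an apex adjacent to x and to all of C₁.
  ApexK9==-straddling : ∀ S {x y} → x ∈ S → y ∈ S →
                        ¬ (∃ λ v → φ₂ v ≡ x) → ¬ (∃ λ u → φ₁ u ≡ y) → HasK9== (addVertex G S)
  ApexK9==-straddling S x∈S y∈S x∉φ₂ y∉φ₁
    with onlyOnSide₁ _ x∉φ₂ | Gluing.onlyOnSide₁ swap _ y∉φ₁
  ... | u , φ₁u≡x , u∉C₁ | w , φ₂w≡y , w∉C₂ =
    HasK9==-minor (apex₁ T (u V.∷ Clique.vtx C₁) (cons-injective (Clique.inj C₁ _ _) u∉C₁) members) minor
    where
    open Absorption gl (dom₂ C₂ w w∉C₂) (subst (_∈ S) (sym φ₂w≡y) y∈S)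
    members : ∀ i → (u V.∷ Clique.vtx C₁) i ∈ T
    members zero    = x∈p∪q⁺ (inj₁ (∈-subset⁺ (λ v → φ₁ v ∈? S) (subst (_∈ S) (sym φ₁u≡x) x∈S)))
    members (suc i) = x∈p∪q⁺ (inj₂ (∈-image⁺ (Clique.vtx C₁) ∈⊤))

  ApexK9==-glue : ApexK9== G₂ → ApexK9== G
  ApexK9==-glue apex₂ S e e-inj e∈S with all? (λ i → any? (λ v → φ₂ v ≟ᶠ e i))
  ... | yes e⊆φ₂ = ApexK9==-pullback φ₂ φ₂-injective φ₂-hom apex₂ S e e-inj e∈S e⊆φ₂
  ... | no e⊈φ₂ with all? (λ i → any? (λ u → φ₁ u ≟ᶠ e i))
  ...   | yes e⊆φ₁ = ApexK9==-pullback φ₁ φ₁-injective φ₁-hom apex₁ S e e-inj e∈S e⊆φ₁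
  ...   | no e⊈φ₁ with ¬∀⟶∃¬ _ _ (λ i → any? (λ v → φ₂ v ≟ᶠ e i)) e⊈φ₂
                     | ¬∀⟶∃¬ _ _ (λ i → any? (λ u → φ₁ u ≟ᶠ e i)) e⊈φ₁
  ...     | i , ei∉φ₂ | j , ej∉φ₁ = ApexK9==-straddling S (e∈S i) (e∈S j) ei∉φ₂ ej∉φ₁

cockade-properties : ∀ {G} → IsCockade (K 8) K22222 5 G → ApexK9== G × CliqueDominable G 5
cockade-properties (base₁ G≅K8) =
  ApexK9==-≅ G≅K8 ApexK9==-K8 , CliqueDominable-≅ G≅K8 (CliqueDominable-K 8 5)
cockade-properties (base₂ G≅K22222) =
  ApexK9==-≅ G≅K22222 ApexK9==-K22222 , CliqueDominable-≅ G≅K22222 (CliqueDominable-K22222 5)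
cockade-properties (glue c₁ c₂ _ _ gl) with cockade-properties c₁ | cockade-properties c₂
... | apex₁ , dom₁ | apex₂ , dom₂ = ApexK9==-glue gl apex₁ dom₂ apex₂ , CliqueDominable-glue gl dom₁ dom₂

lemma2p2 : (G' : Graph) → IsCockade (K 8) K22222 5 G' →
             (S : Subset (n G')) → 6 ≤ ∣ S ∣ →
             HasK9== (addVertex G' S)
lemma2p2 G' cockade S 6≤∣S∣ with ≤∣∣⇒injection S 6 6≤∣S∣
... | e , e-inj , e∈S = proj₁ (cockade-properties cockade) S e e-inj e∈S
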